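{- Let $\mathcal{S}=(s_i)_{i=0}^\infty$ be any binary sequence (i.e. $s_i\in\mathbb{F}_2$ for all $i$) and let $N\ge 1$ be an integer. Then $$M(\mathcal{S},N)\ \ge\ N-2^{M(\mathcal{S},N)+1}\max_{1\le k\le M(\mathcal{S},N)+1} C_k(\mathcal{S},N),$$ where $M(\mathcal{S},N)$ is the $N$th maximum-order complexity and $C_k(\mathcal{S},N)$ the $N$th correlation measure of order $k$ of $\mathcal{S}$, as defined below.
   Context: For a binary sequence $\mathcal{S}=(s_i)_{i=0}^\infty$ over $\mathbb{F}_2$ and a positive integer $N$, the $N$th maximum-order complexity $M(\mathcal{S},N)$ is the smallest positive integer $M$ such that there is a polynomial $f(x_1,\ldots,x_M)\in\mathbb{F}_2[x_1,\ldots,x_M]$ with $s_{i+M}=f(s_i,s_{i+1},\ldots,s_{i+M-1})$ for all $0\le i\le N-M-1$. For a positive integer $k$, the $N$th correlation measure of order $k$ is $$C_k(\mathcal{S},N)=\max_{U,D}\left|\sum_{i=0}^{U-1}(-1)^{s_{i+d_1}+s_{i+d_2}+\cdots+s_{i+d_k}}\right|,$$ where the maximum is taken over all tuples $D=(d_1,\ldots,d_k)$ of integers with $0\le d_1<d_2<\cdots<d_k$ and all positive integers $U$ with $U+d_k\le N$ (here $s_j\in\{0,1\}$ is viewed as an integer in the exponent). -}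

module Defs where

open import Data.Bool using (Bool; true; false; _xor_; _∧_; if_then_else_)
open import Data.Nat using (ℕ; zero; suc; _+_; _*_; _∸_; _^_; _≤_; _<_; _⊔_)
open import Data.Fin as F using (Fin; toℕ)
open import Data.List using (List; []; _∷_; map; foldr; upTo; concatMap)
open import Data.Integer as ℤ using (ℤ; ∣_∣)
open import Data.Product using (Σ; _×_)
open import Relation.Binary.PropositionalEquality using (_≡_)
open import Relation.Nullary using (¬_)

-- Binary sequences over F₂ (F₂ represented by Bool: false = 0, true = 1,
-- addition = xor, multiplication = ∧).
Seq : Set
Seq = ℕ → Bool

-- Polynomials in F₂[x₁,…,x_M]: a finite list of monomials, each given by its
-- exponent vector (Fin M → ℕ), all with coefficient 1; repeated monomials add
-- up mod 2, so every polynomial over F₂ is represented.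
Poly : ℕ → Set
Poly M = List (Fin M → ℕ)

powB : Bool → ℕ → Bool
powB b zero    = true
powB b (suc e) = b ∧ powB b e

prodB : (M : ℕ) → (Fin M → Bool) → Bool
prodB zero    g = true
prodB (suc M) g = g F.zero ∧ prodB M (λ j → g (F.suc j))


evalMono : {M : ℕ} → (Fin M → ℕ) → (Fin M → Bool) → Bool
evalMono {M} e x = prodB M (λ j → powB (x j) (e j))

evalPoly : {M : ℕ} → Poly M → (Fin M → Bool) → Bool
evalPoly p x = foldr (λ e acc → evalMono e x xor acc) false p

HasRecurrence : Seq → ℕ → ℕ → Set
HasRecurrence s N M =
  Σ (Poly M) λ f → ∀ i → i + M < N → s (i + M) ≡ evalPoly f (λ j → s (i + toℕ j))

IsMaxOrderComplexity : Seq → ℕ → ℕ → Set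
IsMaxOrderComplexity s N M =
  1 ≤ M × HasRecurrence s N M × (∀ M' → 1 ≤ M' → M' < M → ¬ HasRecurrence s N M')

range : ℕ → ℕ → List ℕ
range lo b = map (lo +_) (upTo (b ∸ lo))

incTuples : ℕ → ℕ → ℕ → List (List ℕ)
incTuples zero    lo b = [] ∷ []
incTuples (suc k) lo b = concatMap (λ d → map (d ∷_) (incTuples k (suc d) b)) (range lo b)

xorAt : Seq → ℕ → List ℕ → Bool
xorAt s i D = foldr (λ d acc → s (i + d) xor acc) false D

sign : Bool → ℤ
sign b = if b then ℤ.-[1+ 0 ] else ℤ.+ 1

corrSum : Seq → ℕ → List ℕ → ℤ
corrSum s U D = foldr (λ i acc → sign (xorAt s i D) ℤ.+ acc) (ℤ.+ 0) (upTo U)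

maximum : List ℕ → ℕ
maximum = foldr _⊔_ 0

-- C_k(S,N): maximum over 1 ≤ U ≤ N and 0 ≤ d₁ < … < d_k with U + d_k ≤ N
-- (i.e. d_k < N - U + 1). Empty maximum is 0.
corrMeasure : Seq → ℕ → ℕ → ℕ
corrMeasure s k N =
  maximum (concatMap (λ u → map (λ D → ∣ corrSum s (suc u) D ∣)
                                  (incTuples k 0 (suc (N ∸ suc u))))
                     (upTo N))

maxCorr : Seq → ℕ → ℕ → ℕ
maxCorr s K N = maximum (map (λ k → corrMeasure s (suc k) N) (upTo K))

module Submission where

-- Let s satisfy a recurrence s_{i+M} = f(s_i,…,s_{i+M-1}) for i + M < N,
-- write U = N - M for the number of length-(M+1) windows and c = f(0,…,0).
-- No window (s_i,…,s_{i+M}) equals the word a = 0…0 (1+c), since a window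
-- starting with M zeros ends in f(0,…,0) = c.  Hence for every i < U
--     ∏_{t=0}^{M} (1 + (-1)^{s_{i+t} + a_t}) = 0 .
-- Summing over i and expanding the product over the subsets E of {0,…,M},
-- the empty subset contributes U and every other subset contributes ± a
-- correlation sum of order |E| ≤ M+1, bounded by C = max_k C_k(s,N).
-- So 0 ≥ U - (2^{M+1} - 1)·C, which is the theorem.

open import Defs
open import Data.Nat as ℕ using (ℕ; zero; suc; _+_; _*_; _^_; _∸_; _≤_; _<_; _≟_; z≤n; s≤s)
import Data.Nat.Properties as ℕP
open import Data.Bool using (Bool; true; false; not; _xor_; _∧_)
open import Data.Bool.Properties
  using (xor-identityʳ; xor-comm; xor-inverseˡ; true-xor; ¬-not; not-¬; xor-∧-commutativeRing)
  renaming (_≟_ to _≟𝔹_)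
open import Data.Integer as ℤ using (ℤ; +_; -[1+_]; ∣_∣; +≤+)
import Data.Integer.Properties as ℤP
open import Data.List using (List; []; _∷_; map; foldr; upTo; downFrom; length; concatMap)
open import Data.List.Properties using (length-upTo)
open import Data.List.Membership.Propositional using (_∈_)
open import Data.List.Membership.Propositional.Properties
  using (∈-map⁺; ∈-concat⁺′; ∈-upTo⁺; ∈-upTo⁻; ∈-downFrom⁺)
open import Data.List.Relation.Unary.Any using (here; there)
open import Data.Fin as F using (Fin; toℕ)
open import Data.Fin.Properties using (toℕ<n; any?)
open import Data.Product using (∃; _×_; _,_)
open import Algebra.Bundles using (CommutativeRing)
import Algebra.Properties.CommutativeSemigroup as CommSemigroupProperties
open import Relation.Binary.PropositionalEquality
open import Relation.Nullary using (yes; no; does)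
open import Relation.Nullary.Decidable using (dec-true; dec-false)

open CommSemigroupProperties ℤP.+-commutativeSemigroup
  using () renaming (interchange to +-interchange)
open CommSemigroupProperties (CommutativeRing.+-commutativeSemigroup xor-∧-commutativeRing)
  using () renaming (interchange to xor-interchange)

-- Integer sums over a list of indices.  `corrSum s U D` is definitionally
-- `sumℤ (λ i → sign (xorAt s i D)) (upTo U)`.

sumℤ : (ℕ → ℤ) → List ℕ → ℤ
sumℤ f = foldr (λ i acc → f i ℤ.+ acc) (+ 0)

sumℤ-cong : ∀ {f g} xs → (∀ i → f i ≡ g i) → sumℤ f xs ≡ sumℤ g xs
sumℤ-cong []       f≗g = refl
sumℤ-cong (x ∷ xs) f≗g = cong₂ ℤ._+_ (f≗g x) (sumℤ-cong xs f≗g)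

sumℤ-+ : ∀ f g xs → sumℤ (λ i → f i ℤ.+ g i) xs ≡ sumℤ f xs ℤ.+ sumℤ g xs
sumℤ-+ f g []       = refl
sumℤ-+ f g (x ∷ xs) = trans (cong (λ r → (f x ℤ.+ g x) ℤ.+ r) (sumℤ-+ f g xs))
                            (+-interchange (f x) (g x) (sumℤ f xs) (sumℤ g xs))

sumℤ-neg : ∀ f xs → sumℤ (λ i → ℤ.- f i) xs ≡ ℤ.- sumℤ f xs
sumℤ-neg f []       = refl
sumℤ-neg f (x ∷ xs) = trans (cong (λ r → ℤ.- f x ℤ.+ r) (sumℤ-neg f xs))
                            (sym (ℤP.neg-distrib-+ (f x) (sumℤ f xs)))

sumℤ-zero : ∀ f xs → (∀ {i} → i ∈ xs → f i ≡ + 0) → sumℤ f xs ≡ + 0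
sumℤ-zero f []       f≡0 = refl
sumℤ-zero f (x ∷ xs) f≡0 =
  cong₂ ℤ._+_ (f≡0 (here refl)) (sumℤ-zero f xs (λ i∈xs → f≡0 (there i∈xs)))

sumℤ-one : ∀ xs → sumℤ (λ _ → + 1) xs ≡ + length xs
sumℤ-one []       = refl
sumℤ-one (x ∷ xs) = cong (λ r → + 1 ℤ.+ r) (sumℤ-one xs)

sign-not : ∀ b → sign (not b) ≡ ℤ.- sign b
sign-not true  = refl
sign-not false = refl

-- Adding a constant c to every exponent of a character sum changes at most
-- its sign, so the absolute value is unchanged.
∣sum-sign-xor∣ : ∀ (g : ℕ → Bool) c xs →
  ∣ sumℤ (λ i → sign (g i xor c)) xs ∣ ≡ ∣ sumℤ (λ i → sign (g i)) xs ∣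
∣sum-sign-xor∣ g false xs = cong ∣_∣ (sumℤ-cong xs (λ i → cong sign (xor-identityʳ (g i))))
∣sum-sign-xor∣ g true  xs = begin
  ∣ sumℤ (λ i → sign (g i xor true)) xs ∣  ≡⟨ cong ∣_∣ (sumℤ-cong xs flip) ⟩
  ∣ sumℤ (λ i → ℤ.- sign (g i)) xs ∣       ≡⟨ cong ∣_∣ (sumℤ-neg (λ i → sign (g i)) xs) ⟩
  ∣ ℤ.- sumℤ (λ i → sign (g i)) xs ∣       ≡⟨ ℤP.∣-i∣≡∣i∣ (sumℤ (λ i → sign (g i)) xs) ⟩
  ∣ sumℤ (λ i → sign (g i)) xs ∣           ∎
  where
  open ≡-Reasoning
  flip : ∀ i → sign (g i xor true) ≡ ℤ.- sign (g i)
  flip i = trans (cong sign (trans (xor-comm (g i) true) (true-xor (g i)))) (sign-not (g i))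

-- The exclusive or ⊕_{t ∈ E} z t of a family of bits along a list;
-- `xorAt s i E` is definitionally `xorAll (λ d → s (i + d)) E`.
xorAll : (ℕ → Bool) → List ℕ → Bool
xorAll z = foldr (λ t acc → z t xor acc) false

xorAll-xor : ∀ g h E → xorAll (λ t → g t xor h t) E ≡ xorAll g E xor xorAll h E
xorAll-xor g h []      = refl
xorAll-xor g h (t ∷ E) =
  trans (cong ((g t xor h t) xor_) (xorAll-xor g h E))
        (xor-interchange (g t) (h t) (xorAll g E) (xorAll h E))

-- The expanded product
--   expand z L b = Σ_{F ⊆ L} (-1)^{b + Σ_{t ∈ F} z t} = (-1)^b ∏_{t ∈ L} (1 + (-1)^{z t}),
-- computed one factor at a time.
expand : (ℕ → Bool) → List ℕ → Bool → ℤ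
expand z []      b = sign b
expand z (t ∷ L) b = expand z L b ℤ.+ expand z L (z t xor b)

expand-not : ∀ z L b → expand z L (not b) ≡ ℤ.- expand z L b
expand-not z []      b = sign-not b
expand-not z (t ∷ L) b = begin
  expand z L (not b) ℤ.+ expand z L (z t xor not b)
    ≡⟨ cong (λ c → expand z L (not b) ℤ.+ expand z L c) (xor-not (z t) b) ⟩
  expand z L (not b) ℤ.+ expand z L (not (z t xor b))
    ≡⟨ cong₂ ℤ._+_ (expand-not z L b) (expand-not z L (z t xor b)) ⟩
  ℤ.- expand z L b ℤ.+ ℤ.- expand z L (z t xor b)
    ≡⟨ sym (ℤP.neg-distrib-+ (expand z L b) (expand z L (z t xor b))) ⟩
  ℤ.- (expand z L b ℤ.+ expand z L (z t xor b)) ∎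
  where
  open ≡-Reasoning
  xor-not : ∀ x y → x xor not y ≡ not (x xor y)
  xor-not true  y = refl
  xor-not false y = refl

expand-vanishes : ∀ z {L t} → t ∈ L → z t ≡ true → ∀ b → expand z L b ≡ + 0
expand-vanishes z {t ∷ L} (here refl) zt b rewrite zt | expand-not z L b =
  ℤP.+-inverseʳ (expand z L b)
expand-vanishes z {u ∷ L} (there t∈L) zt b
  rewrite expand-vanishes z t∈L zt b | expand-vanishes z t∈L zt (z u xor b) = refl

data Inc : ℕ → ℕ → List ℕ → Set where
  inc[] : ∀ {lo b} → Inc lo b []
  inc∷  : ∀ {lo b d E} → lo ≤ d → d < b → Inc (suc d) b E → Inc lo b (d ∷ E)

inc-weaken : ∀ {lo b E} → Inc (suc lo) b E → Inc lo b E
inc-weaken inc[]              = inc[]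
inc-weaken (inc∷ lo<d d<b E↑) = inc∷ (ℕP.<⇒≤ lo<d) d<b E↑

inc-length : ∀ {lo b d E} → Inc lo b (d ∷ E) → length (d ∷ E) + lo ≤ b
inc-length {lo} (inc∷ {d = d} lo≤d d<b inc[]) = ℕP.≤-trans (s≤s lo≤d) d<b
inc-length {lo} {b} (inc∷ {d = d} {E = e ∷ E} lo≤d d<b E↑) = begin
  length (d ∷ e ∷ E) + lo      ≤⟨ ℕP.+-monoʳ-≤ (length (d ∷ e ∷ E)) lo≤d ⟩
  length (d ∷ e ∷ E) + d       ≡⟨ sym (ℕP.+-suc (length (e ∷ E)) d) ⟩
  length (e ∷ E) + suc d       ≤⟨ inc-length E↑ ⟩
  b                            ∎
  where open ℕP.≤-Reasoning

inc-mem : ∀ {lo b E} → Inc lo b E → E ∈ incTuples (length E) lo b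
inc-mem inc[] = here refl
inc-mem {lo} {b} (inc∷ {d = d} {E} lo≤d d<b E↑) =
  ∈-concat⁺′ (∈-map⁺ (d ∷_) (inc-mem E↑))
             (∈-map⁺ (λ d → map (d ∷_) (incTuples (length E) (suc d) b)) d∈range)
  where
  d∈range : d ∈ range lo b
  d∈range = subst (_∈ range lo b) (ℕP.m+[n∸m]≡n lo≤d)
                  (∈-map⁺ (λ x → lo + x) (∈-upTo⁺ (ℕP.∸-monoˡ-< d<b lo≤d)))

≤-maximum : ∀ {x} xs → x ∈ xs → x ≤ maximum xs
≤-maximum (x ∷ xs) (here refl) = ℕP.m≤m⊔n x (maximum xs)
≤-maximum (y ∷ xs) (there x∈xs) = ℕP.≤-trans (≤-maximum xs x∈xs) (ℕP.m≤n⊔m y (maximum xs))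

corrSum≤maxCorr : ∀ s N K u {d E} → u < N → Inc 0 (suc (N ∸ suc u)) (d ∷ E) →
                  length E < K → ∣ corrSum s (suc u) (d ∷ E) ∣ ≤ maxCorr s K N
corrSum≤maxCorr s N K u {d} {E} u<N D↑ k<K =
  ℕP.≤-trans (≤-maximum _ inCorrMeasure) (≤-maximum _ inMaxCorr)
  where
  k = length E
  sums : ℕ → List ℕ
  sums v = map (λ D → ∣ corrSum s (suc v) D ∣) (incTuples (suc k) 0 (suc (N ∸ suc v)))
  inCorrMeasure : ∣ corrSum s (suc u) (d ∷ E) ∣ ∈ concatMap sums (upTo N)
  inCorrMeasure = ∈-concat⁺′ (∈-map⁺ (λ D → ∣ corrSum s (suc u) D ∣) (inc-mem D↑))
                             (∈-map⁺ sums (∈-upTo⁺ u<N))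
  inMaxCorr : corrMeasure s (suc k) N ∈ map (λ l → corrMeasure s (suc l) N) (upTo K)
  inMaxCorr = ∈-map⁺ (λ l → corrMeasure s (suc l) N) (∈-upTo⁺ k<K)

2^suc-double : ∀ j c → 2 ^ suc j * c ≡ 2 ^ j * c + 2 ^ j * c
2^suc-double j c = begin
  2 * 2 ^ j * c               ≡⟨ ℕP.*-assoc 2 (2 ^ j) c ⟩
  2 ^ j * c + (2 ^ j * c + 0) ≡⟨ cong (λ r → 2 ^ j * c + r) (ℕP.+-identityʳ (2 ^ j * c)) ⟩
  2 ^ j * c + 2 ^ j * c       ∎
  where open ≡-Reasoning

∣i∣≤n⇒0≤i+n : ∀ i n → ∣ i ∣ ≤ n → + 0 ℤ.≤ i ℤ.+ + n
∣i∣≤n⇒0≤i+n (+ m)    n _   = +≤+ z≤n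
∣i∣≤n⇒0≤i+n -[1+ m ] n m<n rewrite ℤP.⊖-≥ m<n = +≤+ z≤n

≤-absorb : ∀ {a x} b K → a ℤ.≤ x ℤ.+ + K → ∣ b ∣ ≤ K → a ℤ.≤ (x ℤ.+ b) ℤ.+ + (K + K)
≤-absorb {a} {x} b K a≤x+K ∣b∣≤K = begin
  a                           ≤⟨ a≤x+K ⟩
  x ℤ.+ + K                   ≡⟨ sym (ℤP.+-identityʳ (x ℤ.+ + K)) ⟩
  (x ℤ.+ + K) ℤ.+ + 0         ≤⟨ ℤP.+-monoʳ-≤ (x ℤ.+ + K) (∣i∣≤n⇒0≤i+n b K ∣b∣≤K) ⟩
  (x ℤ.+ + K) ℤ.+ (b ℤ.+ + K) ≡⟨ +-interchange x (+ K) b (+ K) ⟩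
  (x ℤ.+ b) ℤ.+ + (K + K)     ∎
  where open ℤP.≤-Reasoning

-- The counting argument for a word a that occurs in none of the U = K+1
-- windows (s_i,…,s_{i+M}), i ≤ K, of the prefix of length N = M + U.
module ForbiddenWord (s : Seq) (a : ℕ → Bool) (M K : ℕ) where

  U N C : ℕ
  U = suc K
  N = M + U
  C = maxCorr s (M + 1) N

  differs : ℕ → ℕ → Bool
  differs i t = s (i + t) xor a t

  -- partial L E = Σ_{i<U} Σ_{F ⊆ L} (-1)^{Σ_{t ∈ E ∪ F} differs i t}: the part of
  -- the expansion of Σ_i ∏_t (1 + (-1)^{differs i t}) indexed by the subsets
  -- containing E and contained in E ∪ L.
  partial : List ℕ → List ℕ → ℤ
  partial L E = sumℤ (λ i → expand (differs i) L (xorAll (differs i) E)) (upTo U)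

  -- Splitting on whether the subset contains t.
  partial-split : ∀ t L E → partial (t ∷ L) E ≡ partial L E ℤ.+ partial L (t ∷ E)
  partial-split t L E =
    sumℤ-+ (λ i → expand (differs i) L (xorAll (differs i) E))
           (λ i → expand (differs i) L (xorAll (differs i) (t ∷ E))) (upTo U)

  ∣partial[]∣ : ∀ E → ∣ partial [] E ∣ ≡ ∣ corrSum s U E ∣
  ∣partial[]∣ E = trans
    (cong ∣_∣ (sumℤ-cong (upTo U) (λ i → cong sign (xorAll-xor (λ t → s (i + t)) a E))))
    (∣sum-sign-xor∣ (λ i → xorAt s i E) (xorAll a E) (upTo U))

  -- Each of the 2^j subsets counted by partial (downFrom j) (d ∷ E) is a
  -- nonempty increasing list of lags in [0, M], so contributes at most C.
  partial-bound : ∀ j {d E} → Inc j (suc M) (d ∷ E) → ∣ partial (downFrom j) (d ∷ E) ∣ ≤ 2 ^ j * C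
  partial-bound zero {d} {E} D↑ = begin
    ∣ partial [] (d ∷ E) ∣    ≡⟨ ∣partial[]∣ (d ∷ E) ⟩
    ∣ corrSum s U (d ∷ E) ∣   ≤⟨ corrSum≤maxCorr s N (M + 1) K K<N lags lengthE<M+1 ⟩
    C                         ≡⟨ sym (ℕP.*-identityˡ C) ⟩
    1 * C                     ∎
    where
    open ℕP.≤-Reasoning
    K<N : K < N
    K<N = ℕP.m≤n+m U M
    lags : Inc 0 (suc (N ∸ U)) (d ∷ E)
    lags = subst (λ b → Inc 0 (suc b) (d ∷ E)) (sym (ℕP.m+n∸n≡m M U)) D↑
    lengthE<M+1 : length E < M + 1
    lengthE<M+1 = subst (length E <_) (ℕP.+-comm 1 M)
                        (subst (_≤ suc M) (ℕP.+-identityʳ _) (inc-length D↑))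
  partial-bound (suc j) {d} {E} D↑@(inc∷ j<d d<M+1 _) = begin
    ∣ partial (downFrom (suc j)) (d ∷ E) ∣
      ≡⟨ cong ∣_∣ (partial-split j (downFrom j) (d ∷ E)) ⟩
    ∣ partial (downFrom j) (d ∷ E) ℤ.+ partial (downFrom j) (j ∷ d ∷ E) ∣
      ≤⟨ ℤP.∣i+j∣≤∣i∣+∣j∣ (partial (downFrom j) (d ∷ E)) (partial (downFrom j) (j ∷ d ∷ E)) ⟩
    ∣ partial (downFrom j) (d ∷ E) ∣ + ∣ partial (downFrom j) (j ∷ d ∷ E) ∣
      ≤⟨ ℕP.+-mono-≤ (partial-bound j (inc-weaken D↑))
                     (partial-bound j (inc∷ ℕP.≤-refl j<M+1 D↑)) ⟩
    2 ^ j * C + 2 ^ j * C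
      ≡⟨ sym (2^suc-double j C) ⟩
    2 ^ suc j * C ∎
    where
    open ℕP.≤-Reasoning
    j<M+1 : j < suc M
    j<M+1 = ℕP.<-trans j<d d<M+1

  -- The empty subset contributes U and the remaining 2^j - 1 subsets of
  -- {0,…,j-1} at least -C each.
  partial-lower : ∀ j → j ≤ suc M → + U ℤ.+ + C ℤ.≤ partial (downFrom j) [] ℤ.+ + (2 ^ j * C)
  partial-lower zero _ = ℤP.≤-reflexive (cong₂ ℤ._+_ (sym countWindows)
                                                     (cong +_ (sym (ℕP.*-identityˡ C))))
    where
    countWindows : partial [] [] ≡ + U
    countWindows = trans (sumℤ-one (upTo U)) (cong +_ (length-upTo U))
  partial-lower (suc j) j<M+1 =
    subst (+ U ℤ.+ + C ℤ.≤_) (sym (cong₂ ℤ._+_ (partial-split j (downFrom j) [])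
                                               (cong +_ (2^suc-double j C))))
      (≤-absorb {x = partial (downFrom j) []} (partial (downFrom j) (j ∷ [])) (2 ^ j * C)
                (partial-lower j (ℕP.<⇒≤ j<M+1))
                (partial-bound j (inc∷ ℕP.≤-refl j<M+1 inc[])))

  -- If a occurs in no window, each product ∏_{t ≤ M} (1 + (-1)^{differs i t})
  -- has a vanishing factor.
  partial-vanishes : (∀ i → i < U → ∃ λ t → t ≤ M × s (i + t) ≢ a t) →
                     partial (downFrom (suc M)) [] ≡ + 0
  partial-vanishes avoids = sumℤ-zero _ (upTo U) vanish
    where
    vanish : ∀ {i} → i ∈ upTo U → expand (differs i) (downFrom (suc M)) false ≡ + 0
    vanish {i} i∈ with avoids i (∈-upTo⁻ i∈)
    ... | t , t≤M , mismatch =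
      expand-vanishes (differs i) (∈-downFrom⁺ (s≤s t≤M))
        (trans (cong (_xor a t) (¬-not mismatch)) (xor-inverseˡ (a t))) false

  forbidden-word-bound : (∀ i → i < U → ∃ λ t → t ≤ M × s (i + t) ≢ a t) →
                         N ≤ M + 2 ^ (M + 1) * C
  forbidden-word-bound avoids = ℕP.+-monoʳ-≤ M (begin
    U                ≤⟨ ℕP.m≤m+n U C ⟩
    U + C            ≤⟨ ℤP.drop‿+≤+ lower ⟩
    2 ^ suc M * C    ≡⟨ cong (λ e → 2 ^ e * C) (ℕP.+-comm 1 M) ⟩
    2 ^ (M + 1) * C  ∎)
    where
    open ℕP.≤-Reasoning
    lower : + (U + C) ℤ.≤ + (2 ^ suc M * C)
    lower = subst (+ (U + C) ℤ.≤_)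
              (trans (cong (ℤ._+ + (2 ^ suc M * C)) (partial-vanishes avoids))
                     (ℤP.+-identityˡ (+ (2 ^ suc M * C))))
              (partial-lower (suc M) ℕP.≤-refl)

evalPoly-cong : ∀ {M} (p : Poly M) g h → (∀ j → g j ≡ h j) → evalPoly p g ≡ evalPoly p h
evalPoly-cong     []      g h g≗h = refl
evalPoly-cong {M} (m ∷ p) g h g≗h =
  cong₂ _xor_ (prodB-cong M (λ j → cong (λ x → powB x (m j)) (g≗h j)))
              (evalPoly-cong p g h g≗h)
  where
  prodB-cong : ∀ n {u v : Fin n → Bool} → (∀ j → u j ≡ v j) → prodB n u ≡ prodB n v
  prodB-cong zero    u≗v = refl
  prodB-cong (suc n) u≗v = cong₂ _∧_ (u≗v F.zero) (prodB-cong n (λ j → u≗v (F.suc j)))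

-- The word 0…0 (1 + f(0,…,0)) of length M + 1 attached to f ∈ F₂[x₁,…,x_M].
forbiddenWord : ∀ {M} → Poly M → ℕ → Bool
forbiddenWord {M} f t = does (t ≟ M) ∧ not (evalPoly f (λ _ → false))

-- Under the recurrence s_{i+M} = f(s_i,…,s_{i+M-1}) no window of length M+1
-- equals the forbidden word: a window starting with M zeros ends in f(0,…,0).
recurrence-avoids-word :
  (s : Seq) (N M : ℕ) (f : Poly M) → (∀ i → i + M < N → s (i + M) ≡ evalPoly f (λ j → s (i + toℕ j))) →
  ∀ i → i + M < N → ∃ λ t → t ≤ M × s (i + t) ≢ forbiddenWord f t
recurrence-avoids-word s N M f rec i i+M<N with any? (λ j → s (i + toℕ j) ≟𝔹 true)
... | yes (j , sᵢⱼ≡1) = toℕ j , ℕP.<⇒≤ (toℕ<n j) , mismatch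
  where
  word≡0 : forbiddenWord f (toℕ j) ≡ false
  word≡0 = cong (_∧ not (evalPoly f (λ _ → false))) (dec-false (toℕ j ≟ M) (ℕP.<⇒≢ (toℕ<n j)))
  mismatch : s (i + toℕ j) ≢ forbiddenWord f (toℕ j)
  mismatch eq with trans (sym sᵢⱼ≡1) (trans eq word≡0)
  ... | ()
... | no noOne = M , ℕP.≤-refl , λ eq → not-¬ last≡c (trans eq word≡1+c)
  where
  c = evalPoly f (λ _ → false)
  last≡c : s (i + M) ≡ c
  last≡c = trans (rec i i+M<N)
                 (evalPoly-cong f _ _ (λ j → ¬-not (λ sᵢⱼ≡1 → noOne (j , sᵢⱼ≡1))))
  word≡1+c : forbiddenWord f M ≡ not c
  word≡1+c = cong (_∧ not c) (dec-true (M ≟ M) refl)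

windows : ∀ {M N} → M < N → ∃ λ K → M + suc K ≡ N
windows {M} {N} M<N = N ∸ suc M , trans (ℕP.+-suc M (N ∸ suc M)) (ℕP.m+[n∸m]≡n M<N)

theorem1 : (s : Seq) (N : ℕ) → 1 ≤ N → (M : ℕ) → IsMaxOrderComplexity s N M →
    N ≤ M + 2 ^ (M + 1) * maxCorr s (M + 1) N
theorem1 s N _ M (_ , (f , rec) , _) with N ℕ.≤? M
... | yes N≤M = ℕP.≤-trans N≤M (ℕP.m≤m+n M _)
... | no N≰M with windows (ℕP.≰⇒> N≰M)
...   | K , refl = ForbiddenWord.forbidden-word-bound s (forbiddenWord f) M K
                     (λ i i<U → recurrence-avoids-word s (M + suc K) M f rec i (window-fits i<U))
  where
  window-fits : ∀ {i} → i < suc K → i + M < M + suc K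
  window-fits {i} i<U = subst (_< M + suc K) (ℕP.+-comm M i) (ℕP.+-monoʳ-< M i<U)
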